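{- Let $f_1,f_2:\mathbb{N}\to\mathbb{N}$ be functions. Then there exists a function $f_3:\mathbb{N}\to\mathbb{N}$ with the following property: whenever $\Gamma$ is a connected graph with every vertex of valency at most $d$, $N\le\mathrm{Aut}(\Gamma)$ is such that $(\Gamma,N)$ is $(f_1,f_2)$-bounded, and $G\le\mathrm{Aut}(\Gamma)$ with $N\trianglelefteq G$, then $(\Gamma,G)$ is $(f_1,f_3)$-bounded.
   Context: Graphs are finite and simple. For functions $f_1,f_2:\mathbb{N}\to\mathbb{N}$, a connected graph $\Gamma$ with every vertex of valency at most $d$ and a subgroup $N\le\mathrm{Aut}(\Gamma)$, the pair $(\Gamma,N)$ is called $(f_1,f_2)$-bounded if $N$ has at most $f_1(d)$ orbits on $V\Gamma$ and $|N_\alpha|\le f_2(d)$ for every $\alpha\in V\Gamma$. -}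

module Defs where

open import Data.Nat using (ℕ; _≤_)
open import Data.Fin using (Fin)
open import Data.Fin.Permutation using (Permutation′; _⟨$⟩ʳ_; _≈_; id; flip; _∘ₚ_)
open import Data.List using (List; length)
open import Data.List.Relation.Unary.All using (All)
open import Data.List.Relation.Unary.AllPairs using (AllPairs)
open import Data.Product using (Σ; ∃; _×_; _,_)
open import Relation.Nullary using (¬_)
open import Relation.Binary.PropositionalEquality using (_≡_)
open import Relation.Binary.Construct.Closure.ReflexiveTransitive using (Star)
open import Function.Bundles using (_⇔_)

record Graph (n : ℕ) : Set₁ where
  field
    Adj     : Fin n → Fin n → Set
    Adj-sym : ∀ {u v} → Adj u v → Adj v u
    Adj-irr : ∀ {u} → ¬ Adj u u
open Graph public

Connected : ∀ {n} → Graph n → Set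
Connected Γ = ∀ u v → Star (Adj Γ) u v

-- A subset of a type has at most m elements (distinctness w.r.t. a given relation):
-- every list of pairwise-distinct members has length ≤ m.
AtMost : ∀ {A : Set} → (A → A → Set) → (A → Set) → ℕ → Set
AtMost {A} _~_ P m =
  (xs : List A) → All P xs → AllPairs (λ x y → ¬ (x ~ y)) xs → length xs ≤ m

MaxValency : ∀ {n} → Graph n → ℕ → Set
MaxValency {n} Γ d = ∀ v → AtMost {Fin n} _≡_ (Adj Γ v) d

IsAut : ∀ {n} → Graph n → Permutation′ n → Set
IsAut Γ σ = ∀ u v → Adj Γ u v ⇔ Adj Γ (σ ⟨$⟩ʳ u) (σ ⟨$⟩ʳ v)

record SubgroupAut {n : ℕ} (Γ : Graph n) : Set₁ where
  field
    Mem       : Permutation′ n → Set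
    Mem-resp  : ∀ {σ τ} → σ ≈ τ → Mem σ → Mem τ
    Mem-aut   : ∀ {σ} → Mem σ → IsAut Γ σ
    Mem-id    : Mem id
    Mem-comp  : ∀ {σ τ} → Mem σ → Mem τ → Mem (σ ∘ₚ τ)
    Mem-inv   : ∀ {σ} → Mem σ → Mem (flip σ)
open SubgroupAut public

Normal : ∀ {n} {Γ : Graph n} → SubgroupAut Γ → SubgroupAut Γ → Set
Normal N G =
  (∀ {σ} → Mem N σ → Mem G σ) ×
  (∀ {g h} → Mem G g → Mem N h → Mem N (flip g ∘ₚ h ∘ₚ g))

InOrbit : ∀ {n} {Γ : Graph n} → SubgroupAut Γ → Fin n → Fin n → Set
InOrbit H α β = Σ _ λ g → Mem H g × g ⟨$⟩ʳ α ≡ β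

-- H has at most k orbits on the vertices: some k vertices meet every orbit.
AtMostOrbits : ∀ {n} {Γ : Graph n} → SubgroupAut Γ → ℕ → Set
AtMostOrbits {n} H k = Σ (Fin k → Fin n) λ r → ∀ β → ∃ λ i → InOrbit H (r i) β

Stab : ∀ {n} {Γ : Graph n} → SubgroupAut Γ → Fin n → Permutation′ n → Set
Stab H α g = Mem H g × g ⟨$⟩ʳ α ≡ α

Bounded : (ℕ → ℕ) → (ℕ → ℕ) → (d : ℕ) → ∀ {n} (Γ : Graph n) → SubgroupAut Γ → Set
Bounded f₁ f₂ d Γ H =
  Connected Γ × MaxValency Γ d × AtMostOrbits H (f₁ d) ×
  (∀ α → AtMost _≈_ (Stab H α) (f₂ d))

-- G ⊇ N has at most as many orbits as N, so only |G_α| must be bounded.  Let k = f₁ d,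
-- s = f₂ d and let Ball r be the ball of radius r about α, of size ≤ ballSize d r.
--   * Since N has ≤ k orbits and Γ is connected, every vertex w is moved into Ball k
--     by some e w ∈ N (walk from α, shortcutting whenever an orbit repeats).
--   * g ∈ G_α is determined by w ↦ (g w, g (e w) g⁻¹) on Ball (k+1); by normality
--     these codes lie in a set of ≤ |Ball (k+1)|·|Ball k|·s pairs.
--   * An object determined by its values on b points, each from a set of ≤ v values,
--     ranges over ≤ (v+1)^b possibilities; this bounds |G_α|.
module Submission where

open import Data.Nat using (ℕ; zero; suc; _+_; _*_; _^_; _≤_; z≤n; s≤s; _≤?_)
open import Data.Nat.Properties
  using (≤-refl; ≤-reflexive; ≤-trans; ≤-pred; +-mono-≤; +-suc; *-identityʳ; m≤n+m; n≤1+n; <⇒≤; m^n>0)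
open import Data.Fin as Fin using (Fin)
open import Data.Fin.Properties using (all?) renaming (_≟_ to _≟F_)
open import Data.Fin.Permutation
  using (Permutation′; _⟨$⟩ʳ_; _⟨$⟩ˡ_; _≈_; id; flip; _∘ₚ_; inverseˡ; inverseʳ)
open import Data.List using (List; []; _∷_; length; map)
open import Data.List.Properties using (length-map)
open import Data.List.Relation.Unary.All as All using (All; []; _∷_)
import Data.List.Relation.Unary.All.Properties as All
open import Data.List.Relation.Unary.AllPairs using (AllPairs; []; _∷_)
import Data.List.Relation.Unary.AllPairs.Properties as AllPairs
open import Data.Product using (Σ; ∃; _×_; _,_; proj₁; proj₂)
open import Data.Product.Relation.Binary.Pointwise.NonDependent using (Pointwise; ×-isDecEquivalence)
open import Data.Sum using (_⊎_; inj₁; inj₂)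
open import Data.Empty using (⊥-elim)
open import Function.Bundles using (Equivalence)
open import Relation.Nullary using (¬_; yes; no)
open import Relation.Nullary.Decidable using (decidable-stable)
open import Relation.Unary using (U)
open import Relation.Binary.Definitions using (Decidable; DecidableEquality; Symmetric)
open import Relation.Binary.Structures using (IsDecEquivalence)
open import Relation.Binary.PropositionalEquality
open import Relation.Binary.PropositionalEquality.Properties using () renaming (isDecEquivalence to ≡-isDecEquivalence)
open import Relation.Binary.Construct.Closure.ReflexiveTransitive using (Star; ε; _◅_)

open import Defs

private
  variable
    A B : Set
    _~_ : A → A → Set
    _≃_ : B → B → Set

record Split (S : A → A → Set) (P₁ P₂ : A → Set) (xs : List A) : Set₁ where
  field
    left right     : List A
    left-all       : All P₁ left
    right-all      : All P₂ right
    left-pairs     : AllPairs S left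
    right-pairs    : AllPairs S right
    length-split   : length left + length right ≡ length xs
    sublists       : ∀ {T : A → Set} → All T xs → All T left × All T right

split : ∀ {S : A → A → Set} {P₁ P₂ : A → Set} xs →
  All (λ x → P₁ x ⊎ P₂ x) xs → AllPairs S xs → Split S P₁ P₂ xs
split [] [] [] = record
  { left = [] ; right = [] ; left-all = [] ; right-all = [] ; left-pairs = [] ; right-pairs = []
  ; length-split = refl ; sublists = λ _ → [] , [] }
split (x ∷ xs) (inj₁ p ∷ ps) (s ∷ ss) = record
  { left = x ∷ left ; right = right ; left-all = p ∷ left-all ; right-all = right-all
  ; left-pairs = proj₁ (sublists s) ∷ left-pairs ; right-pairs = right-pairs
  ; length-split = cong suc length-split
  ; sublists = λ { (t ∷ ts) → (t ∷ proj₁ (sublists ts)) , proj₂ (sublists ts) } }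
  where open Split (split xs ps ss)
split (x ∷ xs) (inj₂ p ∷ ps) (s ∷ ss) = record
  { left = left ; right = x ∷ right ; left-all = left-all ; right-all = p ∷ right-all
  ; left-pairs = left-pairs ; right-pairs = proj₂ (sublists s) ∷ right-pairs
  ; length-split = trans (+-suc (length left) (length right)) (cong suc length-split)
  ; sublists = λ { (t ∷ ts) → proj₁ (sublists ts) , (t ∷ proj₂ (sublists ts)) } }
  where open Split (split xs ps ss)

atMost-mono : ∀ {P P' : A → Set} {m m'} →
  (∀ {x} → P x → P' x) → m ≤ m' → AtMost _~_ P' m → AtMost _~_ P m'
atMost-mono P⊆P' m≤m' bound xs ps ds = ≤-trans (bound xs (All.map P⊆P' ps) ds) m≤m'

atMost-zero : ∀ {P : A → Set} {x} → AtMost _~_ P 0 → ¬ P x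
atMost-zero {x = x} bound px with bound (x ∷ []) (px ∷ []) ([] ∷ [])
... | ()

atMost-delete : ∀ {P : A → Set} {x m} → Symmetric _~_ →
  AtMost _~_ P (suc m) → P x → AtMost _~_ (λ y → P y × ¬ y ~ x) m
atMost-delete {x = x} sym bound px ys qs ds =
  ≤-pred (bound (x ∷ ys) (px ∷ All.map proj₁ qs) (All.map (λ q x~y → proj₂ q (sym x~y)) qs ∷ ds))

atMost-∪ : ∀ {P₁ P₂ : A → Set} {a b} →
  AtMost _~_ P₁ a → AtMost _~_ P₂ b → AtMost _~_ (λ x → P₁ x ⊎ P₂ x) (a + b)
atMost-∪ {a = a} {b} bound₁ bound₂ xs ps ds =
  subst (_≤ a + b) length-split
    (+-mono-≤ (bound₁ left left-all left-pairs) (bound₂ right right-all right-pairs))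
  where open Split (split xs ps ds)

atMost-⋃ : Decidable _≃_ → Symmetric _≃_ →
  (F : A → B → Set) → (∀ {a b b'} → F a b → b ≃ b' → F a b') →
  ∀ {Q : B → Set} {q m} → AtMost _≃_ Q q → (∀ {b} → Q b → AtMost _~_ (λ a → F a b) m) →
  AtMost _~_ (λ a → Σ B λ b → Q b × F a b) (q * m)
atMost-⋃ _≟_ sym F resp Q-bound fibre [] _ _ = z≤n
atMost-⋃ _≟_ sym F resp {q = zero} Q-bound fibre (_ ∷ _) ((_ , qb , _) ∷ _) _ =
  ⊥-elim (atMost-zero Q-bound qb)
atMost-⋃ {B = B} {_≃_ = _≃_} {_~_ = _~_} _≟_ sym F resp {Q} {suc q} {m} Q-bound fibre xs ps@((b₀ , qb₀ , _) ∷ _) ds =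
  subst (_≤ m + q * m) length-split
    (+-mono-≤ (fibre qb₀ left left-all left-pairs)
              (atMost-⋃ _≟_ sym F resp (atMost-delete sym Q-bound qb₀) (λ qb → fibre (proj₁ qb))
                        right right-all right-pairs))
  where
  classify : ∀ {a} → (Σ B λ b → Q b × F a b) → F a b₀ ⊎ (Σ B λ b → (Q b × ¬ b ≃ b₀) × F a b)
  classify (b , qb , fab) with b ≟ b₀
  ... | yes b≃b₀ = inj₁ (resp fab b≃b₀)
  ... | no b≄b₀ = inj₂ (b , (qb , b≄b₀) , fab)
  open Split (split {S = λ x y → ¬ x ~ y} {P₁ = λ a → F a b₀} xs (All.map classify ps) ds)

atMost-singleton : ∀ {a : A} → AtMost _≡_ (_≡ a) 1
atMost-singleton [] _ _ = z≤n
atMost-singleton (_ ∷ []) _ _ = s≤s z≤n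
atMost-singleton (_ ∷ _ ∷ _) (x≡a ∷ y≡a ∷ _) ((x≢y ∷ _) ∷ _) = ⊥-elim (x≢y (trans x≡a (sym y≡a)))

atMost-Fin : ∀ {k} {P : Fin k → Set} → AtMost _≡_ P k
atMost-Fin {zero} [] _ _ = z≤n
atMost-Fin {zero} (() ∷ _) _ _
atMost-Fin {suc k} {P} =
  atMost-mono classify (≤-reflexive (cong suc (*-identityʳ k)))
    (atMost-∪ atMost-singleton
      (atMost-⋃ _≟F_ sym (λ x i → x ≡ Fin.suc i) (λ { x≡i refl → x≡i })
                (atMost-Fin {k} {λ i → P (Fin.suc i)}) (λ _ → atMost-singleton)))
  where
  classify : ∀ {x} → P x → x ≡ Fin.zero ⊎ Σ (Fin k) λ i → P (Fin.suc i) × x ≡ Fin.suc i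
  classify {Fin.zero} _ = inj₁ refl
  classify {Fin.suc i} px = inj₂ (i , px , refl)

allPairs-restrict : ∀ {P : A → Set} {S S' : A → A → Set} →
  (∀ {x y} → P x → P y → S x y → S' x y) → ∀ {xs} → All P xs → AllPairs S xs → AllPairs S' xs
allPairs-restrict f [] [] = []
allPairs-restrict f (p ∷ ps) (s ∷ ss) =
  All.zipWith (λ (q , sxy) → f p q sxy) (ps , s) ∷ allPairs-restrict f ps ss

atMost-pullback : ∀ {P : A → Set} {Q : B → Set} {m} (h : A → B) →
  (∀ {x} → P x → Q (h x)) → (∀ {x y} → P x → P y → h x ≃ h y → x ~ y) →
  AtMost _≃_ Q m → AtMost _~_ P m
atMost-pullback h into reflect bound xs ps ds =
  subst (_≤ _) (length-map h xs)
    (bound (map h xs) (All.map⁺ (All.map into ps))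
           (AllPairs.map⁺ (allPairs-restrict (λ px py x≁y hx≃hy → x≁y (reflect px py hx≃hy)) ps ds)))

-- Elements a ∈ P give maps
-- φ a : X → Y; if a is determined (up to ≈ᴬ) by the values of φ a on a domain D of
-- at most b points, and these values lie in a set V of at most v points, then P has
-- at most (v+1)^b elements.  (The +1 absorbs the case D = ∅, where |P| ≤ 1.)
module Determined {A X Y : Set} (_≈ᴬ_ : A → A → Set) {_~_ : Y → Y → Set}
  (~-isDecEquivalence : IsDecEquivalence _~_) (_≟X_ : DecidableEquality X)
  (φ : A → X → Y) {V : Y → Set} {v : ℕ} (V-bound : AtMost _~_ V v) where

  open IsDecEquivalence ~-isDecEquivalence renaming (refl to ~-refl; sym to ~-sym; trans to ~-trans; _≟_ to _≟Y_)

  ValuesIn : (X → Set) → (A → Set) → Set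
  ValuesIn D P = ∀ {a x} → P a → D x → V (φ a x)

  DeterminedOn : (X → Set) → (A → Set) → Set
  DeterminedOn D P = ∀ {a a'} → P a → P a' → (∀ {x} → D x → φ a x ~ φ a' x) → a ≈ᴬ a'

  mutual
    atMost-determined : ∀ b {D P} → AtMost _≡_ D b → ValuesIn D P → DeterminedOn D P →
      AtMost _≈ᴬ_ P (suc v ^ b)
    atMost-determined b _ _ _ [] _ _ = z≤n
    atMost-determined b _ _ _ (_ ∷ []) _ _ = m^n>0 (suc v) b
    atMost-determined b D-bound values determined as@(_ ∷ _ ∷ _) ps@(p₀ ∷ p₁ ∷ _) ds@((a₀≉a₁ ∷ _) ∷ _) =
      -- two distinct elements force D to be inhabited; the goal is decidable, so a
      -- point of D may be obtained by contradiction
      decidable-stable (length as ≤? suc v ^ b) λ too-long →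
        a₀≉a₁ (determined p₀ p₁ λ x∈D →
          ⊥-elim (too-long (atMost-determined-at b D-bound values determined x∈D as ps ds)))

    -- Given a point x₀ ∈ D, sort P by the value at x₀; each class is determined
    -- on D ∖ {x₀}, which has at most b - 1 points.
    atMost-determined-at : ∀ b {D P x₀} → AtMost _≡_ D b → ValuesIn D P → DeterminedOn D P →
      D x₀ → AtMost _≈ᴬ_ P (suc v ^ b)
    atMost-determined-at zero D-bound _ _ x₀∈D = ⊥-elim (atMost-zero D-bound x₀∈D)
    atMost-determined-at (suc b) {D} {P} {x₀} D-bound values determined x₀∈D =
      atMost-mono (λ {a} pa → φ a x₀ , values pa x₀∈D , pa , ~-refl) (m≤n+m (v * suc v ^ b) (suc v ^ b))
        (atMost-⋃ _≟Y_ ~-sym (λ a y → P a × φ a x₀ ~ y) (λ (pa , e) e' → pa , ~-trans e e')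
          V-bound class-bound)
      where
      agree-on-D : ∀ {a a' y} → φ a x₀ ~ y → φ a' x₀ ~ y →
        (∀ {x} → D x × ¬ x ≡ x₀ → φ a x ~ φ a' x) → ∀ {x} → D x → φ a x ~ φ a' x
      agree-on-D a↦y a'↦y agree {x} x∈D with x ≟X x₀
      ... | yes refl = ~-trans a↦y (~-sym a'↦y)
      ... | no x≢x₀ = agree (x∈D , x≢x₀)

      class-bound : ∀ {y} → V y → AtMost _≈ᴬ_ (λ a → P a × φ a x₀ ~ y) (suc v ^ b)
      class-bound _ = atMost-determined b (atMost-delete sym D-bound x₀∈D)
        (λ (pa , _) (x∈D , _) → values pa x∈D)
        (λ (pa , a↦y) (pa' , a'↦y) agree → determined pa pa' (agree-on-D a↦y a'↦y agree))

ballSize : ℕ → ℕ → ℕ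
ballSize d zero = 1
ballSize d (suc r) = 1 + ballSize d r * d

module Balls {n : ℕ} (Γ : Graph n) (α : Fin n) where

  data Ball : ℕ → Fin n → Set where
    centre : ∀ {r} → Ball r α
    step   : ∀ {r u v} → Ball r u → Adj Γ u v → Ball (suc r) v

  ball-≤ : ∀ {l r v} → Ball l v → l ≤ r → Ball r v
  ball-≤ centre _ = centre
  ball-≤ (step b a) (s≤s l≤r) = step (ball-≤ b l≤r) a

  ball-suc : ∀ {r v} → Ball r v → Ball (suc r) v
  ball-suc {r} b = ball-≤ b (n≤1+n r)

  ball-aut : ∀ {σ} → IsAut Γ σ → σ ⟨$⟩ʳ α ≡ α → ∀ {r v} → Ball r v → Ball r (σ ⟨$⟩ʳ v)
  ball-aut aut fix centre = subst (Ball _) (sym fix) centre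
  ball-aut {σ} aut fix (step {u = u} {v} b a) = step (ball-aut {σ} aut fix b) (Equivalence.to (aut u v) a)

  -- |Ball (r+1)| ≤ 1 + d·|Ball r|: a vertex of Ball (r+1) is α or a neighbour of Ball r.
  ball-bound : ∀ {d} → MaxValency Γ d → ∀ r → AtMost _≡_ (Ball r) (ballSize d r)
  ball-bound _ zero = atMost-mono centre-only ≤-refl atMost-singleton
    where
    centre-only : ∀ {v} → Ball zero v → v ≡ α
    centre-only centre = refl
  ball-bound valency (suc r) =
    atMost-mono centre-or-neighbour ≤-refl
      (atMost-∪ atMost-singleton
        (atMost-⋃ _≟F_ sym (λ v u → Adj Γ u v) (λ { a refl → a }) (ball-bound valency r) (λ {u} _ → valency u)))
    where
    centre-or-neighbour : ∀ {v} → Ball (suc r) v → v ≡ α ⊎ Σ (Fin n) λ u → Ball r u × Adj Γ u v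
    centre-or-neighbour centre = inj₁ refl
    centre-or-neighbour (step b a) = inj₂ (_ , b , a)

-- Let rep : Fin k → Fin n meet every N-orbit.  Walking
-- from α to β we keep an element c ∈ N and a path from α to c(v) (v the current
-- vertex) whose vertices lie in pairwise distinct N-orbits.  When the next vertex
-- c(v') is in the orbit of some vertex q on the path, we multiply c by an element of
-- N sending c(v') to q and cut the path at q.  Such a path has fewer than k vertices,
-- so every vertex is mapped into Ball k by some element of N.
module IntoBall {n : ℕ} (Γ : Graph n) (α : Fin n) (N : SubgroupAut Γ) {k : ℕ}
  (rep : Fin k → Fin n) (meets : ∀ β → ∃ λ i → InOrbit N (rep i) β) where

  open Balls Γ α

  label : Fin n → Fin k
  label β = proj₁ (meets β)

  carry : Fin n → Permutation′ n
  carry β = proj₁ (proj₂ (meets β))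

  carry-mem : ∀ β → Mem N (carry β)
  carry-mem β = proj₁ (proj₂ (proj₂ (meets β)))

  carry-rep : ∀ β → carry β ⟨$⟩ʳ rep (label β) ≡ β
  carry-rep β = proj₂ (proj₂ (proj₂ (meets β)))

  same-orbit : ∀ {β γ} → label β ≡ label γ → Σ (Permutation′ n) λ c → Mem N c × c ⟨$⟩ʳ β ≡ γ
  same-orbit {β} {γ} β∼γ =
    flip (carry β) ∘ₚ carry γ , Mem-comp N (Mem-inv N (carry-mem β)) (carry-mem γ) ,
    (begin
      carry γ ⟨$⟩ʳ (carry β ⟨$⟩ˡ β)               ≡⟨ cong (λ x → carry γ ⟨$⟩ʳ (carry β ⟨$⟩ˡ x)) (sym (carry-rep β)) ⟩
      carry γ ⟨$⟩ʳ (carry β ⟨$⟩ˡ (carry β ⟨$⟩ʳ rep (label β)))  ≡⟨ cong (carry γ ⟨$⟩ʳ_) (inverseˡ (carry β)) ⟩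
      carry γ ⟨$⟩ʳ rep (label β)                  ≡⟨ cong (λ i → carry γ ⟨$⟩ʳ rep i) β∼γ ⟩
      carry γ ⟨$⟩ʳ rep (label γ)                  ≡⟨ carry-rep γ ⟩
      γ                                           ∎)
    where open ≡-Reasoning

  data Path : Fin n → ℕ → Set where
    start : Path α 0
    _▷_   : ∀ {u v l} → Path u l → Adj Γ u v → Path v (suc l)

  labels : ∀ {v l} → Path v l → List (Fin k)
  labels start = label α ∷ []
  labels (_▷_ {v = v} p _) = label v ∷ labels p

  length-labels : ∀ {v l} (p : Path v l) → length (labels p) ≡ suc l
  length-labels start = refl
  length-labels (p ▷ _) = cong suc (length-labels p)

  path-ball : ∀ {v l} → Path v l → Ball l v
  path-ball start = centre
  path-ball (p ▷ a) = step (path-ball p) a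

  Distinct : List (Fin k) → Set
  Distinct = AllPairs (λ i j → ¬ i ≡ j)

  -- A path with distinct labels has at most k vertices, so it stays inside Ball k.
  distinct-path-ball : ∀ {v l} (p : Path v l) → Distinct (labels p) → Ball k v
  distinct-path-ball {l = l} p ds =
    ball-≤ (path-ball p) (<⇒≤ (subst (_≤ k) (length-labels p) (atMost-Fin {P = U} (labels p) (All.universal-U (labels p)) ds)))

  record Prefix (i : Fin k) : Set where
    constructor prefix
    field
      {end len} : _
      path      : Path end len
      end-label : label end ≡ i
      distinct  : Distinct (labels path)

  find-label : ∀ i {v l} (p : Path v l) → Distinct (labels p) → Prefix i ⊎ All (λ j → ¬ i ≡ j) (labels p)
  find-label i start ds with i ≟F label α
  ... | yes i≡ = inj₁ (prefix start (sym i≡) ds)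
  ... | no i≢ = inj₂ (i≢ ∷ [])
  find-label i (_▷_ {v = v} p a) (d ∷ ds) with i ≟F label v
  ... | yes i≡ = inj₁ (prefix (p ▷ a) (sym i≡) (d ∷ ds))
  ... | no i≢ with find-label i p ds
  ...   | inj₁ pre = inj₁ pre
  ...   | inj₂ fresh = inj₂ (i≢ ∷ fresh)

  record Moved (v : Fin n) : Set where
    constructor moved
    field
      c        : Permutation′ n
      c∈N      : Mem N c
      {len}    : ℕ
      path     : Path (c ⟨$⟩ʳ v) len
      distinct : Distinct (labels path)

  advance : ∀ {v v'} → Moved v → Adj Γ v v' → Moved v'
  advance {v} {v'} (moved c c∈N p ds) v-v' with find-label (label (c ⟨$⟩ʳ v')) p ds
  ... | inj₂ fresh = moved c c∈N (p ▷ Equivalence.to (Mem-aut N c∈N v v') v-v') (fresh ∷ ds)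
  ... | inj₁ (prefix p' end∼ ds') = shortcut p' ds' (same-orbit (sym end∼))
    where
    shortcut : ∀ {e l} (p' : Path e l) → Distinct (labels p') →
      (Σ (Permutation′ n) λ c' → Mem N c' × c' ⟨$⟩ʳ (c ⟨$⟩ʳ v') ≡ e) → Moved v'
    shortcut p' ds' (c' , c'∈N , refl) = moved (c ∘ₚ c') (Mem-comp N c∈N c'∈N) p' ds'

  walk : ∀ {u v} → Star (Adj Γ) u v → Moved u → Moved v
  walk ε m = m
  walk (a ◅ as) m = walk as (advance m a)

  into-ball : Connected Γ → ∀ β → Σ (Permutation′ n) λ c → Mem N c × Ball k (c ⟨$⟩ʳ β)
  into-ball connected β with walk (connected α β) (moved id (Mem-id N) start ([] ∷ []))
  ... | moved c c∈N p ds = c , c∈N , distinct-path-ball p ds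

-- Conjugation h ↦ g h g⁻¹ (σ ∘ₚ τ applies σ first).
conj : ∀ {n} → Permutation′ n → Permutation′ n → Permutation′ n
conj g h = flip g ∘ₚ h ∘ₚ g

conj-∘ : ∀ {n} (g h h' : Permutation′ n) → conj g (h ∘ₚ h') ≈ conj g h ∘ₚ conj g h'
conj-∘ g h h' x = cong (λ y → g ⟨$⟩ʳ (h' ⟨$⟩ʳ y)) (sym (inverseˡ g))

⟨$⟩ʳ-injective : ∀ {n} (σ : Permutation′ n) {a b} → σ ⟨$⟩ʳ a ≡ σ ⟨$⟩ʳ b → a ≡ b
⟨$⟩ʳ-injective σ {a} {b} σa≡σb = trans (sym (inverseˡ σ)) (trans (cong (σ ⟨$⟩ˡ_) σa≡σb) (inverseˡ σ))

≈-isDecEquivalence : ∀ {n} → IsDecEquivalence (_≈_ {n} {n})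
≈-isDecEquivalence = record
  { isEquivalence = record
    { refl = λ _ → refl ; sym = λ σ≈τ i → sym (σ≈τ i) ; trans = λ σ≈τ τ≈ρ i → trans (σ≈τ i) (τ≈ρ i) }
  ; _≟_ = λ σ τ → all? (λ i → σ ⟨$⟩ʳ i ≟F τ ⟨$⟩ʳ i) }

stabiliserBound : (d k s : ℕ) → ℕ
stabiliserBound d k s = suc (ballSize d (suc k) * (ballSize d k * s)) ^ ballSize d (suc k)

-- Choose e w ∈ N with e w (w) ∈ Ball k.  An element g ∈ G_α
-- is determined by the code w ↦ (g w, g (e w) g⁻¹) on Ball (k+1), and the codes lie
-- in a set of at most |Ball (k+1)|·|Ball k|·s pairs, since g (e w) g⁻¹ ∈ N by normality.
module StabiliserBound {n : ℕ} (Γ : Graph n) (connected : Connected Γ) {d : ℕ}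
  (valency : MaxValency Γ d) (N G : SubgroupAut Γ) (N⊴G : Normal N G) {k s : ℕ}
  (rep : Fin k → Fin n) (meets : ∀ β → ∃ λ i → InOrbit N (rep i) β)
  (N-stab : ∀ β → AtMost _≈_ (Stab N β) s) (α : Fin n) where

  open Balls Γ α
  open IntoBall Γ α N rep meets using (into-ball)

  e : Fin n → Permutation′ n
  e w = proj₁ (into-ball connected w)

  e∈N : ∀ w → Mem N (e w)
  e∈N w = proj₁ (proj₂ (into-ball connected w))

  e-ball : ∀ w → Ball k (e w ⟨$⟩ʳ w)
  e-ball w = proj₂ (proj₂ (into-ball connected w))

  Code : Set
  Code = Fin n × Permutation′ n

  _≋_ : Code → Code → Set
  _≋_ = Pointwise _≡_ _≈_

  encode : Permutation′ n → Fin n → Code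
  encode g w = g ⟨$⟩ʳ w , conj g (e w)

  Admissible : Code → Set
  Admissible (y , m) = Ball (suc k) y × Mem N m × Ball k (m ⟨$⟩ʳ y)

  encode-admissible : ∀ {g} → Stab G α g → ∀ {w} → Ball (suc k) w → Admissible (encode g w)
  encode-admissible {g} (g∈G , gα≡α) {w} w∈B =
    ball-aut {g} (Mem-aut G g∈G) gα≡α w∈B ,
    proj₂ N⊴G g∈G (e∈N w) ,
    subst (Ball k) (cong (λ x → g ⟨$⟩ʳ (e w ⟨$⟩ʳ x)) (sym (inverseˡ g)))
      (ball-aut {g} (Mem-aut G g∈G) gα≡α (e-ball w))

  Sends : Fin n → Fin n → Permutation′ n → Set
  Sends y z m = Mem N m × m ⟨$⟩ʳ y ≡ z

  -- The elements of N sending y to z form a coset of N_z, so there are at most s.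
  coset-bound : ∀ y z → AtMost _≈_ (Sends y z) s
  coset-bound y z [] _ _ = z≤n
  coset-bound y z ms@(m₀ ∷ _) ps@((m₀∈N , m₀y≡z) ∷ _) =
    atMost-pullback (λ m → flip m₀ ∘ₚ m) into-stab reflect (N-stab z) ms ps
    where
    into-stab : ∀ {m} → Sends y z m → Stab N z (flip m₀ ∘ₚ m)
    into-stab {m} (m∈N , my≡z) =
      Mem-comp N (Mem-inv N m₀∈N) m∈N ,
      trans (cong (m ⟨$⟩ʳ_) (trans (cong (m₀ ⟨$⟩ˡ_) (sym m₀y≡z)) (inverseˡ m₀))) my≡z
    reflect : ∀ {m m'} → Sends y z m → Sends y z m' → flip m₀ ∘ₚ m ≈ flip m₀ ∘ₚ m' → m ≈ m'
    reflect {m} {m'} _ _ agree i =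
      trans (cong (m ⟨$⟩ʳ_) (sym (inverseˡ m₀))) (trans (agree (m₀ ⟨$⟩ʳ i)) (cong (m' ⟨$⟩ʳ_) (inverseˡ m₀)))

  admissible-bound : AtMost _≋_ Admissible (ballSize d (suc k) * (ballSize d k * s))
  admissible-bound =
    atMost-mono (λ { {y , m} (y∈B , m∈N , my∈B) → y , y∈B , refl , m∈N , my∈B }) ≤-refl
      (atMost-⋃ _≟F_ sym (λ (y , m) y' → y ≡ y' × Mem N m × Ball k (m ⟨$⟩ʳ y)) (λ { p refl → p })
        (ball-bound valency (suc k)) λ {y'} _ →
      atMost-mono (λ { {y , m} (y≡y' , m∈N , my∈B) → m ⟨$⟩ʳ y , my∈B , y≡y' , m∈N , refl }) ≤-refl
        (atMost-⋃ _≟F_ sym (λ (y , m) z → y ≡ y' × Sends y z m) (λ { p refl → p })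
          (ball-bound valency k) λ {z} _ →
        atMost-pullback proj₂ (λ { (refl , m∈N , my≡z) → m∈N , my≡z })
          (λ { (refl , _) (refl , _) m≈m' → refl , m≈m' }) (coset-bound y' z)))

  -- Codes agreeing on Ball (k+1) force equality.  Walking from α to v we keep
  -- c ∈ N with c v ∈ Ball k and g c g⁻¹ = g' c g'⁻¹; then g (c v) = g' (c v)
  -- gives g v = g' v.
  module _ (g g' : Permutation′ n) (agree : ∀ {w} → Ball (suc k) w → encode g w ≋ encode g' w) where

    Invariant : Fin n → Set
    Invariant v = Σ (Permutation′ n) λ c → Mem N c × Ball k (c ⟨$⟩ʳ v) × conj g c ≈ conj g' c

    advance : ∀ {v v'} → Invariant v → Adj Γ v v' → Invariant v'
    advance {v} {v'} (c , c∈N , cv∈B , conj≈) v-v' =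
      c ∘ₚ e w , Mem-comp N c∈N (e∈N w) , e-ball w , λ x → begin
        conj g (c ∘ₚ e w) ⟨$⟩ʳ x               ≡⟨ conj-∘ g c (e w) x ⟩
        conj g (e w) ⟨$⟩ʳ (conj g c ⟨$⟩ʳ x)     ≡⟨ cong (conj g (e w) ⟨$⟩ʳ_) (conj≈ x) ⟩
        conj g (e w) ⟨$⟩ʳ (conj g' c ⟨$⟩ʳ x)    ≡⟨ proj₂ (agree w∈B) (conj g' c ⟨$⟩ʳ x) ⟩
        conj g' (e w) ⟨$⟩ʳ (conj g' c ⟨$⟩ʳ x)   ≡⟨ sym (conj-∘ g' c (e w) x) ⟩
        conj g' (c ∘ₚ e w) ⟨$⟩ʳ x              ∎
      where
      open ≡-Reasoning
      w = c ⟨$⟩ʳ v'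
      w∈B : Ball (suc k) w
      w∈B = step cv∈B (Equivalence.to (Mem-aut N c∈N v v') v-v')

    walk : ∀ {u v} → Star (Adj Γ) u v → Invariant u → Invariant v
    walk ε inv = inv
    walk (a ◅ as) inv = walk as (advance inv a)

    encode-injective : g ≈ g'
    encode-injective v with walk (connected α v) (id , Mem-id N , centre , λ _ → trans (inverseʳ g) (sym (inverseʳ g')))
    ... | c , _ , cv∈B , conj≈ = begin
        g ⟨$⟩ʳ v                       ≡⟨ sym (inverseʳ g') ⟩
        g' ⟨$⟩ʳ (g' ⟨$⟩ˡ (g ⟨$⟩ʳ v))   ≡⟨ cong (g' ⟨$⟩ʳ_) (sym v≡) ⟩
        g' ⟨$⟩ʳ v                      ∎
      where
      open ≡-Reasoning
      g'cv≡ : g' ⟨$⟩ʳ (c ⟨$⟩ʳ v) ≡ g' ⟨$⟩ʳ (c ⟨$⟩ʳ (g' ⟨$⟩ˡ (g ⟨$⟩ʳ v)))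
      g'cv≡ = begin
        g' ⟨$⟩ʳ (c ⟨$⟩ʳ v)                    ≡⟨ sym (proj₁ (agree (ball-suc cv∈B))) ⟩
        g ⟨$⟩ʳ (c ⟨$⟩ʳ v)                     ≡⟨ cong (λ x → g ⟨$⟩ʳ (c ⟨$⟩ʳ x)) (sym (inverseˡ g)) ⟩
        conj g c ⟨$⟩ʳ (g ⟨$⟩ʳ v)              ≡⟨ conj≈ (g ⟨$⟩ʳ v) ⟩
        g' ⟨$⟩ʳ (c ⟨$⟩ʳ (g' ⟨$⟩ˡ (g ⟨$⟩ʳ v)))  ∎
      v≡ : v ≡ g' ⟨$⟩ˡ (g ⟨$⟩ʳ v)
      v≡ = ⟨$⟩ʳ-injective c (⟨$⟩ʳ-injective g' g'cv≡)

  open Determined _≈_ (×-isDecEquivalence (≡-isDecEquivalence _≟F_) ≈-isDecEquivalence) _≟F_ encode admissible-bound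

  stabiliser-bound : AtMost _≈_ (Stab G α) (stabiliserBound d k s)
  stabiliser-bound = atMost-determined (ballSize d (suc k)) (ball-bound valency (suc k))
    (λ g∈Gα w∈B → encode-admissible g∈Gα w∈B) (λ {g} {g'} _ _ agree → encode-injective g g' agree)

orbits-supergroup : ∀ {n} {Γ : Graph n} {H K : SubgroupAut Γ} {k} →
  (∀ {σ} → Mem H σ → Mem K σ) → AtMostOrbits H k → AtMostOrbits K k
orbits-supergroup H⊆K (rep , meets) =
  rep , λ β → let (i , g , g∈H , g-rep≡β) = meets β in i , g , H⊆K g∈H , g-rep≡β

theorem1p10 : (f₁ f₂ : ℕ → ℕ) → ∃ λ (f₃ : ℕ → ℕ) →
    ∀ (d n : ℕ) (Γ : Graph n) → Connected Γ → MaxValency Γ d →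
    (N G : SubgroupAut Γ) → Bounded f₁ f₂ d Γ N → Normal N G →
    Bounded f₁ f₃ d Γ G
theorem1p10 f₁ f₂ =
  (λ d → stabiliserBound d (f₁ d) (f₂ d)) ,
  λ d n Γ connected valency N G (_ , _ , N-orbits@(rep , meets) , N-stab) N⊴G →
    connected , valency , orbits-supergroup {H = N} {G} (proj₁ N⊴G) N-orbits ,
    StabiliserBound.stabiliser-bound Γ connected valency N G N⊴G rep meets N-stab
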